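{- Let $\mathbb F$ be a field, $d\ge1$, and let $z_{i,j}\in\mathbb F$ ($i\ge 1$, $0\le j\le d$) with $z_{i,j}\ne z_{i,j'}$ for $j\ne j'$. Given an $n$-variate polynomial $P$ over $\mathbb F$ with individual degree at most $d$ and total degree at most $D$, the algorithm TrimmedEval described below outputs the correct values $P(Z_\ell)$ for all $\ell\in\binom{[n]}{\le D}_d$.
   Context: For $\ell\in\{0,\dots,d\}^n$, $Z_\ell=(z_{1,\ell_1},\dots,z_{n,\ell_n})$; $\binom{[n]}{\le D}_d=\{\ell\in\{0,\dots,d\}^n:\sum_i\ell_i\le D\}$. For $z_0,\dots,z_d\in\mathbb F$, $V(z_0,\dots,z_d)$ is the $(d+1)\times(d+1)$ Vandermonde matrix with entries $V_{j,i}=z_j^i$ ($0\le i,j\le d$). Algorithm TrimmedEval$(P)$ (with $n$ variables, individual degree $d$, total degree $D$): (1) If $n=0$, return the constant $P$. (2) Write $P(X_1,\dots,X_n)=\sum_{i=0}^d P_i(X_1,\dots,X_{n-1})X_n^i$. (3) Compute an LU decomposition $V(z_{n,0},\dots,z_{n,d})=L\cdot U$ with $L$ lower triangular and $U$ upper triangular. (4) Compute the polynomials $Q_j=\sum_{i=j}^d U_{j,i}P_i$ for $j=0,\dots,d$. (5) For $j=0,\dots,d$, recursively call TrimmedEval$(Q_j)$ (as an $(n-1)$-variate polynomial of total degree at most $D-j$) to obtain $Q_j(Z_{\ell'})$ for all $\ell'\in\binom{[n-1]}{\le D-j}_d$. (6) For each $\ell'\in\binom{[n-1]}{\le D}_d$,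 let $k=\min\{d,D-\sum_{j=1}^{n-1}\ell'_j\}$ and compute, for $j=0,\dots,k$, $P(Z_{(\ell',j)})=\sum_{i=0}^{j}L_{j,i}Q_i(Z_{\ell'})$. -}

module Defs where

open import Level using (Level; _⊔_)
open import Data.Nat as ℕ using (ℕ; zero; suc; _+_; _∸_; _≤_; _<_; z≤n; s≤s; _≤?_)
open import Data.Nat.Properties using (≤-trans; +-monoʳ-≤; +-identityʳ; +-suc)
open import Data.Fin using (Fin; zero; suc; toℕ; fromℕ; inject₁)
open import Data.Product using (Σ; _×_; _,_)
open import Relation.Binary.PropositionalEquality using (_≡_; _≢_; subst; sym)
open import Relation.Nullary using (¬_; yes; no)
open import Algebra.Bundles using (CommutativeRing)

record Field (c ℓ : Level) : Set (Level.suc (c ⊔ ℓ)) where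
  field
    commutativeRing : CommutativeRing c ℓ
  open CommutativeRing commutativeRing public
  field
    0#≉1#   : ¬ (0# ≈ 1#)
    inverse : ∀ x → ¬ (x ≈ 0#) → Σ Carrier (λ y → (x * y) ≈ 1#)

+≤⇒≤∸ : ∀ a i D → a + i ≤ D → a ≤ D ∸ i
+≤⇒≤∸ a zero D h = subst (_≤ D) (+-identityʳ a) h
+≤⇒≤∸ a (suc i) zero h rewrite +-suc a i with h
... | ()
+≤⇒≤∸ a (suc i) (suc D) h rewrite +-suc a i with h
... | s≤s h' = +≤⇒≤∸ a i D h'

module _ {c ℓ : Level} (F : Field c ℓ) (d : ℕ) where
  open Field F using (Carrier; _≈_; 0#; 1#) renaming (_+_ to _+F_; _*_ to _*F_)

  Σᵈ : (Fin (suc d) → Carrier) → Carrier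
  Σᵈ f = go (suc d) f
    where
    go : (m : ℕ) → (Fin m → Carrier) → Carrier
    go zero    f = 0#
    go (suc m) f = f zero +F go m (λ k → f (suc k))

  pow : Carrier → ℕ → Carrier
  pow x zero    = 1#
  pow x (suc k) = x *F pow x k

  -- n-variate polynomials over F in X_1..X_n with individual degree ≤ d,
  -- written (constructor split) as  P = Σ_{i=0}^{d} P_i(X_1..X_{n-1}) X_n^i  (the
  -- decomposition of step (2)); a 0-variate polynomial is a constant.
  data Poly : ℕ → Set c where
    const : Carrier → Poly zero
    split : ∀ {n} → (Fin (suc d) → Poly n) → Poly (suc n)

  -- exponent vectors ℓ ∈ {0..d}^n; component n (the last one) is the
  -- exponent of X_n.
  Exps : ℕ → Set
  Exps n = Fin n → Fin (suc d)

  init : ∀ {n} → Exps (suc n) → Exps n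
  init ℓ k = ℓ (inject₁ k)

  last : ∀ {n} → Exps (suc n) → Fin (suc d)
  last {n} ℓ = ℓ (fromℕ n)

  ∣_∣ₑ : ∀ {n} → Exps n → ℕ
  ∣_∣ₑ {zero}  ℓ = 0
  ∣_∣ₑ {suc n} ℓ = ∣ init ℓ ∣ₑ + toℕ (last ℓ)

  coeff : ∀ {n} → Poly n → Exps n → Carrier
  coeff (const c) e = c
  coeff (split P) e = coeff (P (last e)) (init e)

  TotDeg≤ : ∀ {n} → Poly n → ℕ → Set ℓ
  TotDeg≤ {n} P D = ∀ (e : Exps n) → D < ∣ e ∣ₑ → coeff P e ≈ 0#

  eval : ∀ {n} → Poly n → (Fin n → Carrier) → Carrier
  eval (const c) x = c
  eval {suc n} (split P) x = Σᵈ (λ i → eval (P i) (λ k → x (inject₁ k)) *F pow (x (fromℕ n)) (toℕ i))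

  _·ₚ_ : ∀ {n} → Carrier → Poly n → Poly n
  a ·ₚ const c = const (a *F c)
  a ·ₚ split P = split (λ i → a ·ₚ P i)

  _+ₚ_ : ∀ {n} → Poly n → Poly n → Poly n
  const p +ₚ const q = const (p +F q)
  split P +ₚ split Q = split (λ i → P i +ₚ Q i)

  0ₚ : ∀ {n} → Poly n
  0ₚ {zero}  = const 0#
  0ₚ {suc n} = split (λ i → 0ₚ)

  Σₚ : ∀ {n} → (Fin (suc d) → Poly n) → Poly n
  Σₚ f = go (suc d) f
    where
    go : ∀ {n} (m : ℕ) → (Fin m → Poly n) → Poly n
    go zero    f = 0ₚ
    go (suc m) f = f zero +ₚ go m (λ k → f (suc k))

  Mat : Set c
  Mat = Fin (suc d) → Fin (suc d) → Carrier

  Vandermonde : (Fin (suc d) → Carrier) → Mat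
  Vandermonde z j i = pow (z j) (toℕ i)

  record LUDecomposition (V : Mat) : Set (c ⊔ ℓ) where
    field
      L U    : Mat
      L-lower : ∀ j i → toℕ j < toℕ i → L j i ≈ 0#
      U-upper : ∀ j i → toℕ i < toℕ j → U j i ≈ 0#
      V≈LU    : ∀ j i → V j i ≈ Σᵈ (λ k → L j k *F U k i)

  -- Nodes: z i j  is z_{i+1,j}, i.e. variable X_{i+1} (0-based index i)
  -- uses the nodes z i 0, …, z i d.
  Nodes : Set c
  Nodes = ℕ → Fin (suc d) → Carrier

  Z : ∀ {n} → Nodes → Exps n → Fin n → Carrier
  Z z ℓ k = z (toℕ k) (ℓ k)

  -- Algorithm TrimmedEval, parametrised by the LU decompositions chosen in
  -- step (3) (one for the Vandermonde matrix of each variable's nodes).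
  -- The output is a table of values indexed by ℓ ∈ binom([n], ≤ D)_d.
  TrimmedEval : (z : Nodes) → (lu : ∀ m → LUDecomposition (Vandermonde (z m))) →
                (n D : ℕ) → Poly n → (ℓ : Exps n) → ∣ ℓ ∣ₑ ≤ D → Carrier
  TrimmedEval z lu zero D (const c) ℓ h = c
  TrimmedEval z lu (suc n) D (split P) ℓ h = value
    where
    open LUDecomposition (lu n)
    Q : Fin (suc d) → Poly n
    Q j = Σₚ (λ i → Qterm i (toℕ j ≤? toℕ i))
      where
      Qterm : (i : Fin (suc d)) → Relation.Nullary.Dec (toℕ j ≤ toℕ i) → Poly n
      Qterm i (yes _) = U j i ·ₚ P i
      Qterm i (no _)  = 0ₚ
    -- (5) recursive calls, Q_j of total degree ≤ D - j
    R : (j : Fin (suc d)) → (ℓ' : Exps n) → ∣ ℓ' ∣ₑ ≤ D ∸ toℕ j → Carrier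
    R j = TrimmedEval z lu n (D ∸ toℕ j) (Q j)
    -- (6) ℓ = (ℓ', j) with j ≤ k = min{d, D - |ℓ'|}:
    --     P(Z_(ℓ',j)) = Σ_{i=0}^{j} L_{j,i} Q_i(Z_ℓ')
    j  = last ℓ
    ℓ' = init ℓ
    term : (i : Fin (suc d)) → Relation.Nullary.Dec (toℕ i ≤ toℕ j) → Carrier
    term i (yes i≤j) = L j i *F R i ℓ' (+≤⇒≤∸ ∣ ℓ' ∣ₑ (toℕ i) D
                          (≤-trans (+-monoʳ-≤ ∣ ℓ' ∣ₑ i≤j) h))
    term i (no _)    = 0#
    value = Σᵈ (λ i → term i (toℕ i ≤? toℕ j))

{-# OPTIONS --safe #-}

-- Write P = Σᵢ Pᵢ Xₙ^i and V = LU for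
-- the Vandermonde matrix of the last variable's nodes.  Since U is upper
-- triangular, Qⱼ = Σᵢ U_{j,i} Pᵢ only involves the Pᵢ with i ≥ j, whose total
-- degree is at most D − i ≤ D − j, so the recursive calls return the values
-- Qⱼ(Z_ℓ′).  Since L is lower triangular, step (6) computes
--   Σᵢ L_{j,i} Qᵢ(Z_ℓ′) = Σₘ (LU)_{j,m} Pₘ(Z_ℓ′) = Σₘ z_{n,j}^m Pₘ(Z_ℓ′) = P(Z_(ℓ′,j)).
-- Such an LU decomposition exists for arbitrary nodes w: L_{j,k} = Nₖ(w_j) for
-- the Newton basis Nₖ(x) = Π_{m<k} (x − wₘ), and U_{k,i} is the coefficient of
-- Nₖ in x^i.

module Submission where

open import Defs
open import Level using (Level)
open import Data.Nat using (ℕ; suc; _≤_)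
open import Data.Fin using (Fin)
open import Data.Product using (_×_)
open import Relation.Binary.PropositionalEquality using (_≢_)
open import Relation.Nullary using (¬_)

open import Level using (_⊔_)
open import Data.Nat as ℕ using (zero; _<_; _∸_; _≤?_; _<?_; s<s; z<s)
open import Data.Nat.Properties
  using (≤-trans; ≤-<-trans; m≤m+n; m≤n+m∸n; +-comm; +-monoʳ-≤; +-monoʳ-<;
         ∸-monoʳ-≤; ≰⇒>; ≮⇒≥; m<n⇒m<1+n; m<1+n⇒m<n∨m≡n)
open import Data.Fin using (zero; suc; toℕ; fromℕ; inject₁)
open import Data.Fin.Properties using (toℕ<n; toℕ-fromℕ; toℕ-inject₁)
open import Data.Product using (_,_)
open import Data.Sum using (inj₁; inj₂)
open import Function using (_∘_)
open import Relation.Binary.PropositionalEquality as ≡ using (_≡_; _≗_)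
open import Relation.Nullary using (yes; no)
import Algebra.Properties.Semiring.Sum as Sum
import Algebra.Solver.Ring.NaturalCoefficients.Default as NatSolver
import Relation.Binary.Reasoning.Setoid as SetoidReasoning

m∸n<o⇒m<o+n : ∀ m n {o} → m ∸ n < o → m < o ℕ.+ n
m∸n<o⇒m<o+n m n {o} lt = ≡.subst (m <_) (+-comm n o) (≤-<-trans (m≤n+m∸n m n) (+-monoʳ-< n lt))

clamp : ∀ d → ℕ → Fin (suc d)
clamp d       zero    = zero
clamp zero    (suc k) = zero
clamp (suc d) (suc k) = suc (clamp d k)

clamp-toℕ : ∀ {d} (i : Fin (suc d)) → clamp d (toℕ i) ≡ i
clamp-toℕ             zero    = ≡.refl
clamp-toℕ {d = suc d} (suc i) = ≡.cong suc (clamp-toℕ i)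

module _ {c ℓ : Level} (F : Field c ℓ) where
  open Field F hiding (zero)
  open Sum semiring
    using (sum; sum-syntax; sum-cong-≋; sum-cong-≗; sum-replicate-zero; sum-init-last;
           ∑-distrib-+; ∑-comm; *-distribˡ-sum; *-distribʳ-sum)
  open NatSolver commutativeSemiring using (solve; _:=_; _:+_; _:*_)
  open SetoidReasoning setoid

  x-y+y≈x : ∀ x y → x - y + y ≈ x
  x-y+y≈x x y = trans (+-assoc x (- y) y) (trans (+-congˡ (-‿inverseˡ y)) (+-identityʳ x))

  sum-zero : ∀ {m} {f : Fin m → Carrier} → (∀ i → f i ≈ 0#) → sum f ≈ 0#
  sum-zero {m} f≈0 = trans (sum-cong-≋ f≈0) (sum-replicate-zero m)

  ∑-shift : ∀ K (a : ℕ → Carrier) → a zero ≈ 0# → a (suc K) ≈ 0# →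
            ∑[ k < suc K ] a (toℕ k) ≈ ∑[ k < suc K ] a (suc (toℕ k))
  ∑-shift K a a₀≈0 a₁₊K≈0 = begin
    a zero + ∑[ k < K ] a (suc (toℕ k))                              ≈⟨ +-congʳ a₀≈0 ⟩
    0# + ∑[ k < K ] a (suc (toℕ k))                                  ≈⟨ +-identityˡ _ ⟩
    ∑[ k < K ] a (suc (toℕ k))                                       ≈⟨ +-identityʳ _ ⟨
    ∑[ k < K ] a (suc (toℕ k)) + 0#                                  ≈⟨ +-cong (reflexive inits) (sym lastK) ⟩
    ∑[ k < K ] a (suc (toℕ (inject₁ k))) + a (suc (toℕ (fromℕ K)))  ≈⟨ sum-init-last (λ k → a (suc (toℕ k))) ⟨
    ∑[ k < suc K ] a (suc (toℕ k))                                   ∎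
    where
    inits : ∑[ k < K ] a (suc (toℕ k)) ≡ ∑[ k < K ] a (suc (toℕ (inject₁ k)))
    inits = sum-cong-≗ {K} (λ k → ≡.cong (a ∘ suc) (≡.sym (toℕ-inject₁ k)))
    lastK : a (suc (toℕ (fromℕ K))) ≈ 0#
    lastK = trans (reflexive (≡.cong (a ∘ suc) (toℕ-fromℕ K))) a₁₊K≈0

  ∑-∑-assoc : ∀ {l m} (a : Fin l → Carrier) (B : Fin l → Fin m → Carrier) (p : Fin m → Carrier) →
              ∑[ i < l ] (a i * ∑[ k < m ] (B i k * p k)) ≈ ∑[ k < m ] (∑[ i < l ] (a i * B i k) * p k)
  ∑-∑-assoc {l} {m} a B p = begin
    ∑[ i < l ] (a i * ∑[ k < m ] (B i k * p k))
      ≈⟨ sum-cong-≋ (λ i → *-distribˡ-sum (a i) (λ k → B i k * p k)) ⟩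
    ∑[ i < l ] ∑[ k < m ] (a i * (B i k * p k))
      ≈⟨ ∑-comm (λ i k → a i * (B i k * p k)) ⟩
    ∑[ k < m ] ∑[ i < l ] (a i * (B i k * p k))
      ≈⟨ sum-cong-≋ (λ k → sum-cong-≋ (λ i → *-assoc (a i) (B i k) (p k))) ⟨
    ∑[ k < m ] ∑[ i < l ] (a i * B i k * p k)
      ≈⟨ sum-cong-≋ (λ k → *-distribʳ-sum (p k) (λ i → a i * B i k)) ⟨
    ∑[ k < m ] (∑[ i < l ] (a i * B i k) * p k)
      ∎

  -- Σᵈ and Σₚ are defined through an unnamed where-bound helper `go`.  Each
  -- metavariable below is instantiated to it by unifying against an unfolding
  -- of the definition made generic by with-abstraction.  `go` does not use the
  -- arguments d and f of the enclosing clause, so conversion ignores them.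
  private
    mutual
      Σᵈ-go : (d : ℕ) → (Fin (suc d) → Carrier) → (m : ℕ) → (Fin m → Carrier) → Carrier
      Σᵈ-go = _

      Σᵈ-go-solution : ∀ d (f : Fin (suc (suc d)) → Carrier) → Σᵈ F (suc d) f ≡ Σᵈ F (suc d) f
      Σᵈ-go-solution d f with f zero | f (suc zero) | (λ (k : Fin d) → f (suc (suc k)))
      ... | a | b | g with suc d | f
      ... | x | f′ = ≡.cong (λ s → a + (b + s)) (≡.refl {x = Σᵈ-go x f′ d g})

    mutual
      Σₚ-go : (d n : ℕ) → (Fin (suc d) → Poly F d n) → (m : ℕ) → (Fin m → Poly F d n) → Poly F d n
      Σₚ-go = _

      Σₚ-go-solution : ∀ d n (f : Fin (suc (suc d)) → Poly F (suc d) n) → Σₚ F (suc d) f ≡ Σₚ F (suc d) f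
      Σₚ-go-solution d n f with f zero | f (suc zero) | (λ (k : Fin d) → f (suc (suc k)))
      ... | a | b | g with suc d | f
      ... | x | f′ = ≡.cong (λ s → _+ₚ_ F x a (_+ₚ_ F x b s)) (≡.refl {x = Σₚ-go x n f′ d g})

  Σᵈ-go≡sum : ∀ d f m (g : Fin m → Carrier) → Σᵈ-go d f m g ≡ sum g
  Σᵈ-go≡sum d f zero    g = ≡.refl
  Σᵈ-go≡sum d f (suc m) g = ≡.cong (g zero +_) (Σᵈ-go≡sum d f m (g ∘ suc))

  Σᵈ≡sum : ∀ d (f : Fin (suc d) → Carrier) → Σᵈ F d f ≡ sum f
  Σᵈ≡sum d f = Σᵈ-go≡sum d f (suc d) f

  record IsLinear {d n : ℕ} (φ : Poly F d n → Carrier) : Set (c ⊔ ℓ) where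
    field
      0ₚ-homo : φ (0ₚ F d) ≈ 0#
      +ₚ-homo : ∀ p q → φ (_+ₚ_ F d p q) ≈ φ p + φ q
      ·ₚ-homo : ∀ a p → φ (_·ₚ_ F d a p) ≈ a * φ p

  module _ {d n : ℕ} {φ : Poly F d n → Carrier} (lin : IsLinear φ) where
    open IsLinear lin

    Σₚ-go-homo : ∀ f m (g : Fin m → Poly F d n) → φ (Σₚ-go d n f m g) ≈ sum (φ ∘ g)
    Σₚ-go-homo f zero    g = 0ₚ-homo
    Σₚ-go-homo f (suc m) g = trans (+ₚ-homo _ _) (+-congˡ (Σₚ-go-homo f m (g ∘ suc)))

    Σₚ-homo : ∀ f → φ (Σₚ F d f) ≈ ∑[ i < suc d ] φ (f i)
    Σₚ-homo f = Σₚ-go-homo f (suc d) f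

  module _ (d : ℕ) where

    eval-split : ∀ {n} (Q : Fin (suc d) → Poly F d n) (x : Fin (suc n) → Carrier) →
                 eval F d (split Q) x ≡
                 ∑[ i < suc d ] (eval F d (Q i) (x ∘ inject₁) * pow F d (x (fromℕ n)) (toℕ i))
    eval-split {n} Q x = Σᵈ≡sum d (λ i → eval F d (Q i) (x ∘ inject₁) * pow F d (x (fromℕ n)) (toℕ i))

    eval-cong : ∀ {n} (P : Poly F d n) {x y : Fin n → Carrier} → x ≗ y → eval F d P x ≡ eval F d P y
    eval-cong (const a) x≗y = ≡.refl
    eval-cong {suc n} (split Q) {x} {y} x≗y =
      ≡.trans (eval-split Q x) (≡.trans (sum-cong-≗ term≡) (≡.sym (eval-split Q y)))
      where
      term≡ : ∀ i → eval F d (Q i) (x ∘ inject₁) * pow F d (x (fromℕ n)) (toℕ i)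
                  ≡ eval F d (Q i) (y ∘ inject₁) * pow F d (y (fromℕ n)) (toℕ i)
      term≡ i = ≡.cong₂ _*_ (eval-cong (Q i) (x≗y ∘ inject₁))
                            (≡.cong (λ v → pow F d v (toℕ i)) (x≗y (fromℕ n)))

    eval-split-Z : ∀ {n} (z : Nodes F d) (P : Fin (suc d) → Poly F d n) (e : Exps F d (suc n)) →
                   eval F d (split P) (Z F d z e) ≡
                   ∑[ m < suc d ] (eval F d (P m) (Z F d z (init F d e)) * pow F d (z n (last F d e)) (toℕ m))
    eval-split-Z {n} z P e = ≡.trans (eval-split P (Z F d z e)) (sum-cong-≗ term≡)
      where
      term≡ : ∀ m → eval F d (P m) (Z F d z e ∘ inject₁) * pow F d (Z F d z e (fromℕ n)) (toℕ m)
                  ≡ eval F d (P m) (Z F d z (init F d e)) * pow F d (z n (last F d e)) (toℕ m)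
      term≡ m = ≡.cong₂ _*_ (eval-cong (P m) (λ k → ≡.cong (λ t → z t (e (inject₁ k))) (toℕ-inject₁ k)))
                            (≡.cong (λ t → pow F d (z t (last F d e)) (toℕ m)) (toℕ-fromℕ n))

    eval-0ₚ : ∀ {n} (x : Fin n → Carrier) → eval F d (0ₚ F d) x ≈ 0#
    eval-0ₚ {zero}  x = refl
    eval-0ₚ {suc n} x = trans (reflexive (eval-split (λ _ → 0ₚ F d) x)) (sum-zero {suc d} term≈0)
      where
      term≈0 : ∀ i → eval F d (0ₚ F d) (x ∘ inject₁) * pow F d (x (fromℕ n)) (toℕ i) ≈ 0#
      term≈0 i = trans (*-congʳ (eval-0ₚ (x ∘ inject₁))) (zeroˡ _)

    eval-+ₚ : ∀ {n} (p q : Poly F d n) x → eval F d (_+ₚ_ F d p q) x ≈ eval F d p x + eval F d q x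
    eval-+ₚ (const a) (const b) x = refl
    eval-+ₚ {suc n} (split p) (split q) x = begin
      eval F d (split (λ i → _+ₚ_ F d (p i) (q i))) x  ≡⟨ eval-split (λ i → _+ₚ_ F d (p i) (q i)) x ⟩
      ∑[ i < suc d ] (eval F d (_+ₚ_ F d (p i) (q i)) x′ * xⁱ i)
        ≈⟨ sum-cong-≋ (λ i → trans (*-congʳ (eval-+ₚ (p i) (q i) x′)) (distribʳ (xⁱ i) _ _)) ⟩
      ∑[ i < suc d ] (pxⁱ i + qxⁱ i)                   ≈⟨ ∑-distrib-+ pxⁱ qxⁱ ⟩
      ∑[ i < suc d ] pxⁱ i + ∑[ i < suc d ] qxⁱ i      ≡⟨ ≡.cong₂ _+_ (eval-split p x) (eval-split q x) ⟨
      eval F d (split p) x + eval F d (split q) x      ∎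
      where
      x′ : Fin n → Carrier
      x′ = x ∘ inject₁
      xⁱ pxⁱ qxⁱ : Fin (suc d) → Carrier
      xⁱ i  = pow F d (x (fromℕ n)) (toℕ i)
      pxⁱ i = eval F d (p i) x′ * xⁱ i
      qxⁱ i = eval F d (q i) x′ * xⁱ i

    eval-·ₚ : ∀ {n} a (p : Poly F d n) x → eval F d (_·ₚ_ F d a p) x ≈ a * eval F d p x
    eval-·ₚ a (const b) x = refl
    eval-·ₚ {suc n} a (split p) x = begin
      eval F d (split (λ i → _·ₚ_ F d a (p i))) x  ≡⟨ eval-split (λ i → _·ₚ_ F d a (p i)) x ⟩
      ∑[ i < suc d ] (eval F d (_·ₚ_ F d a (p i)) x′ * xⁱ i)
        ≈⟨ sum-cong-≋ (λ i → trans (*-congʳ (eval-·ₚ a (p i) x′)) (*-assoc a _ (xⁱ i))) ⟩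
      ∑[ i < suc d ] (a * pxⁱ i)                   ≈⟨ *-distribˡ-sum a pxⁱ ⟨
      a * ∑[ i < suc d ] pxⁱ i                     ≡⟨ ≡.cong (a *_) (eval-split p x) ⟨
      a * eval F d (split p) x                     ∎
      where
      x′ : Fin n → Carrier
      x′ = x ∘ inject₁
      xⁱ pxⁱ : Fin (suc d) → Carrier
      xⁱ i  = pow F d (x (fromℕ n)) (toℕ i)
      pxⁱ i = eval F d (p i) x′ * xⁱ i

    eval-linear : ∀ {n} (x : Fin n → Carrier) → IsLinear (λ P → eval F d P x)
    eval-linear x = record
      { 0ₚ-homo = eval-0ₚ x
      ; +ₚ-homo = λ p q → eval-+ₚ p q x
      ; ·ₚ-homo = λ a p → eval-·ₚ a p x
      }

    coeff-0ₚ : ∀ {n} (e : Exps F d n) → coeff F d (0ₚ F d) e ≈ 0#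
    coeff-0ₚ {zero}  e = refl
    coeff-0ₚ {suc n} e = coeff-0ₚ (init F d e)

    coeff-+ₚ : ∀ {n} (p q : Poly F d n) e → coeff F d (_+ₚ_ F d p q) e ≈ coeff F d p e + coeff F d q e
    coeff-+ₚ (const a) (const b) e = refl
    coeff-+ₚ (split p) (split q) e = coeff-+ₚ (p (last F d e)) (q (last F d e)) (init F d e)

    coeff-·ₚ : ∀ {n} a (p : Poly F d n) e → coeff F d (_·ₚ_ F d a p) e ≈ a * coeff F d p e
    coeff-·ₚ a (const b) e = refl
    coeff-·ₚ a (split p) e = coeff-·ₚ a (p (last F d e)) (init F d e)

    coeff-linear : ∀ {n} (e : Exps F d n) → IsLinear (λ P → coeff F d P e)
    coeff-linear e = record
      { 0ₚ-homo = coeff-0ₚ e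
      ; +ₚ-homo = λ p q → coeff-+ₚ p q e
      ; ·ₚ-homo = λ a p → coeff-·ₚ a p e
      }

    coeff-cong : ∀ {n} (P : Poly F d n) {e e′ : Exps F d n} → e ≗ e′ → coeff F d P e ≡ coeff F d P e′
    coeff-cong (const a) e≗e′ = ≡.refl
    coeff-cong {suc n} (split P) {e} {e′} e≗e′ =
      ≡.trans (≡.cong (λ a → coeff F d (P a) (init F d e)) (e≗e′ (fromℕ n)))
              (coeff-cong (P (last F d e′)) (e≗e′ ∘ inject₁))

    ∣∣ₑ-cong : ∀ {n} {e e′ : Exps F d n} → e ≗ e′ → ∣_∣ₑ F d e ≡ ∣_∣ₑ F d e′
    ∣∣ₑ-cong {zero}  e≗e′ = ≡.refl
    ∣∣ₑ-cong {suc n} e≗e′ = ≡.cong₂ ℕ._+_ (∣∣ₑ-cong (e≗e′ ∘ inject₁)) (≡.cong toℕ (e≗e′ (fromℕ n)))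

    snoc : ∀ {n} → Exps F d n → Fin (suc d) → Exps F d (suc n)
    snoc {zero}  e a zero    = a
    snoc {suc n} e a zero    = e zero
    snoc {suc n} e a (suc k) = snoc (e ∘ suc) a k

    last-snoc : ∀ {n} (e : Exps F d n) a → last F d (snoc e a) ≡ a
    last-snoc {zero}  e a = ≡.refl
    last-snoc {suc n} e a = last-snoc (e ∘ suc) a

    init-snoc : ∀ {n} (e : Exps F d n) a → init F d (snoc e a) ≗ e
    init-snoc {suc n} e a zero    = ≡.refl
    init-snoc {suc n} e a (suc k) = init-snoc (e ∘ suc) a k

    TotDeg≤-split : ∀ {n D} {P : Fin (suc d) → Poly F d n} → TotDeg≤ F d (split P) D →
                    ∀ a → TotDeg≤ F d (P a) (D ∸ toℕ a)
    TotDeg≤-split {n} {D} {P} deg a e D∸a<∣e∣ = begin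
      coeff F d (P a) e               ≡⟨ coeff-cong (P a) (init-snoc e a) ⟨
      coeff F d (P a) e⁺              ≡⟨ ≡.cong (λ b → coeff F d (P b) e⁺) (last-snoc e a) ⟨
      coeff F d (split P) (snoc e a)  ≈⟨ deg (snoc e a) D<∣snoc∣ ⟩
      0#                              ∎
      where
      e⁺ : Exps F d n
      e⁺ = init F d (snoc e a)
      ∣snoc∣ : ∣_∣ₑ F d (snoc e a) ≡ ∣_∣ₑ F d e ℕ.+ toℕ a
      ∣snoc∣ = ≡.cong₂ ℕ._+_ (∣∣ₑ-cong (init-snoc e a)) (≡.cong toℕ (last-snoc e a))
      D<∣snoc∣ : D < ∣_∣ₑ F d (snoc e a)
      D<∣snoc∣ = ≡.subst (D <_) (≡.sym ∣snoc∣) (m∸n<o⇒m<o+n D (toℕ a) D∸a<∣e∣)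

    module Newton (w : ℕ → Carrier) where

      newton : Carrier → ℕ → Carrier
      newton x zero    = 1#
      newton x (suc k) = newton x k * (x - w k)

      newton-root : ∀ {a k} → a < k → newton (w a) k ≈ 0#
      newton-root {a} {suc k} a<1+k with m<1+n⇒m<n∨m≡n a<1+k
      ... | inj₁ a<k    = trans (*-congʳ (newton-root a<k)) (zeroˡ _)
      ... | inj₂ ≡.refl = trans (*-congˡ (-‿inverseʳ (w a))) (zeroʳ _)

      -- With x = (x − wₖ) + wₖ this becomes a semiring identity.
      x*newton : ∀ x a k → x * (a * newton x k) ≈ a * newton x (suc k) + w k * a * newton x k
      x*newton x a k = trans (*-congʳ (sym (x-y+y≈x x (w k))))
        (solve 4 (λ y u b N → (y :+ u) :* (b :* N) := b :* (N :* y) :+ u :* b :* N) refl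
               (x - w k) (w k) a (newton x k))

      shift : (ℕ → Carrier) → ℕ → Carrier
      shift a zero    = 0#
      shift a (suc k) = a k

      -- The recursion comes from x · Nₖ(x) = Nₖ₊₁(x) + wₖ · Nₖ(x).
      newtonCoeff : ℕ → ℕ → Carrier
      newtonCoeff zero    zero    = 1#
      newtonCoeff zero    (suc k) = 0#
      newtonCoeff (suc i) k       = shift (newtonCoeff i) k + w k * newtonCoeff i k

      newtonCoeff-upper : ∀ {i k} → i < k → newtonCoeff i k ≈ 0#
      newtonCoeff-upper {zero}  {suc k} _         = refl
      newtonCoeff-upper {suc i} {suc k} (s<s i<k) = trans
        (+-cong (newtonCoeff-upper i<k) (trans (*-congˡ (newtonCoeff-upper (m<n⇒m<1+n i<k))) (zeroʳ _)))
        (+-identityˡ 0#)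

      pow-newton : ∀ {K} x i → i < K → pow F d x i ≈ ∑[ k < K ] (newtonCoeff i (toℕ k) * newton x (toℕ k))
      pow-newton {suc K} x zero    _         =
        sym (trans (+-cong (*-identityˡ 1#) (sum-zero {K} (λ k → zeroˡ _))) (+-identityʳ 1#))
      pow-newton {suc K} x (suc i) (s<s i<K) = begin
        x * pow F d x i                        ≈⟨ *-congˡ (pow-newton x i (m<n⇒m<1+n i<K)) ⟩
        x * ∑ₖ cᵢN                             ≈⟨ *-distribˡ-sum {suc K} x (cᵢN ∘ toℕ) ⟩
        ∑ₖ (λ k → x * cᵢN k)                   ≈⟨ sum-cong-≋ {suc K} (λ k → x*newton x (cᵢ (toℕ k)) (toℕ k)) ⟩
        ∑ₖ (λ k → cᵢN⁺ k + wcᵢN k)             ≈⟨ ∑-distrib-+ {suc K} (cᵢN⁺ ∘ toℕ) (wcᵢN ∘ toℕ) ⟩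
        ∑ₖ cᵢN⁺ + ∑ₖ wcᵢN                      ≈⟨ +-congʳ (∑-shift K shiftcᵢN (zeroˡ 1#) vanishes) ⟨
        ∑ₖ shiftcᵢN + ∑ₖ wcᵢN                  ≈⟨ ∑-distrib-+ {suc K} (shiftcᵢN ∘ toℕ) (wcᵢN ∘ toℕ) ⟨
        ∑ₖ (λ k → shiftcᵢN k + wcᵢN k)         ≈⟨ sum-cong-≋ {suc K} (regroup ∘ toℕ) ⟨
        ∑ₖ (λ k → newtonCoeff (suc i) k * N k)  ∎
        where
        ∑ₖ : (ℕ → Carrier) → Carrier
        ∑ₖ a = ∑[ k < suc K ] a (toℕ k)
        cᵢ N cᵢN cᵢN⁺ wcᵢN shiftcᵢN : ℕ → Carrier
        cᵢ         = newtonCoeff i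
        N          = newton x
        cᵢN k      = cᵢ k * N k
        cᵢN⁺ k     = cᵢ k * N (suc k)
        wcᵢN k     = w k * cᵢ k * N k
        shiftcᵢN k = shift cᵢ k * N k
        regroup : ∀ k → newtonCoeff (suc i) k * N k ≈ shiftcᵢN k + wcᵢN k
        regroup k = distribʳ (N k) (shift cᵢ k) (w k * cᵢ k)
        vanishes : shiftcᵢN (suc K) ≈ 0#
        vanishes = trans (*-congʳ (newtonCoeff-upper i<K)) (zeroˡ _)

    Vandermonde-LU : (w : Fin (suc d) → Carrier) → LUDecomposition F d (Vandermonde F d w)
    Vandermonde-LU w = record
      { L       = L
      ; U       = U
      ; L-lower = λ j k j<k → trans (reflexive (≡.cong (λ x → newton (w x) (toℕ k)) (≡.sym (clamp-toℕ j))))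
                                    (newton-root j<k)
      ; U-upper = λ k i i<k → newtonCoeff-upper i<k
      ; V≈LU    = V≈LU
      }
      where
      open Newton (w ∘ clamp d)
      L U : Fin (suc d) → Fin (suc d) → Carrier
      L j k = newton (w j) (toℕ k)
      U k i = newtonCoeff (toℕ i) (toℕ k)
      V≈LU : ∀ j i → Vandermonde F d w j i ≈ Σᵈ F d (λ k → L j k * U k i)
      V≈LU j i = begin
        pow F d (w j) (toℕ i)          ≈⟨ pow-newton (w j) (toℕ i) (toℕ<n i) ⟩
        ∑[ k < suc d ] (U k i * L j k)  ≈⟨ sum-cong-≋ {suc d} (λ k → *-comm (U k i) (L j k)) ⟩
        ∑[ k < suc d ] (L j k * U k i)  ≡⟨ Σᵈ≡sum d (λ k → L j k * U k i) ⟨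
        Σᵈ F d (λ k → L j k * U k i)    ∎

    module TrimmedEvalStep (z : Nodes F d) (lu : ∀ m → LUDecomposition F d (Vandermonde F d (z m)))
                           {n D : ℕ} (P : Fin (suc d) → Poly F d n)
                           (e : Exps F d (suc n)) (h : ∣_∣ₑ F d e ≤ D) where
      open LUDecomposition (lu n)

      private
        j : Fin (suc d)
        j = last F d e
        e′ : Exps F d n
        e′ = init F d e
        ∣e′∣≤D : ∣_∣ₑ F d e′ ≤ D
        ∣e′∣≤D = ≤-trans (m≤m+n _ _) h

      -- The polynomials Qⱼ and the summands of steps (4) and (6) are unnamed
      -- helpers of TrimmedEval, obtained as for Σᵈ above.  Index zero is
      -- separate because unfolding Σᵈ and Σₚ reduces the zeroth summand further.
      mutual
        private
          Q₀ : Poly F d n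
          Q₀ = _
          Qₛ : Fin d → Poly F d n
          Qₛ = _
          summandₛ : Fin d → Carrier
          summandₛ = _
          Q-summandₛ : Fin d → Fin d → Poly F d n
          Q-summandₛ = _

        Q : Fin (suc d) → Poly F d n
        Q zero    = Q₀
        Q (suc k) = Qₛ k

        private
          TrimmedEval-unfold : TrimmedEval F d z lu (suc n) D (split P) e h ≡
                               L j zero * TrimmedEval F d z lu n D Q₀ e′ ∣e′∣≤D + Σᵈ-go d (λ _ → 0#) d summandₛ
          TrimmedEval-unfold = ≡.refl

          summandₛ-correct : (r : Fin (suc d) → Carrier) →
                             (∀ i q → TrimmedEval F d z lu n (D ∸ toℕ i) (Q i) e′ q ≈ r i) →
                             ∀ k → summandₛ k ≈ L j (suc k) * r (suc k)
          summandₛ-correct r ih k with suc (toℕ k) ≤? toℕ j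
          ... | yes k<j = *-congˡ (ih (suc k) (+≤⇒≤∸ _ _ D (≤-trans (+-monoʳ-≤ _ k<j) h)))
          ... | no  k≮j = sym (trans (*-congʳ (L-lower j (suc k) (≰⇒> k≮j))) (zeroˡ _))

          Qₛ-unfold : ∀ k → Qₛ k ≡ _+ₚ_ F d (0ₚ F d) (Σₚ-go d n (λ _ → 0ₚ F d) d (Q-summandₛ k))
          Qₛ-unfold k = ≡.refl

      module _ {φ : Poly F d n → Carrier} (lin : IsLinear φ) where
        open IsLinear lin

        private
          Q-summandₛ-linear : ∀ k m → φ (Q-summandₛ k m) ≈ U (suc k) (suc m) * φ (P (suc m))
          Q-summandₛ-linear k m with suc (toℕ k) ≤? suc (toℕ m)
          ... | yes _   = ·ₚ-homo _ _
          ... | no  k≰m = trans 0ₚ-homo (sym (trans (*-congʳ (U-upper (suc k) (suc m) (≰⇒> k≰m))) (zeroˡ _)))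

        Q-linear : ∀ i → φ (Q i) ≈ ∑[ m < suc d ] (U i m * φ (P m))
        Q-linear zero    = trans (Σₚ-homo lin (λ m → _·ₚ_ F d (U zero m) (P m)))
                                 (sum-cong-≋ {suc d} (λ m → ·ₚ-homo (U zero m) (P m)))
        Q-linear (suc k) = begin
          φ (Qₛ k)                                                  ≡⟨ ≡.cong φ (Qₛ-unfold k) ⟩
          φ (_+ₚ_ F d (0ₚ F d) Qₛ-tail)                             ≈⟨ +ₚ-homo _ _ ⟩
          φ (0ₚ F d) + φ Qₛ-tail                                    ≈⟨ +-cong 0ₚ-homo tail-linear ⟩
          0# + ∑[ m < d ] (U (suc k) (suc m) * φ (P (suc m)))       ≈⟨ +-congʳ U₀φ≈0 ⟨
          U (suc k) zero * φ (P zero) + ∑[ m < d ] (U (suc k) (suc m) * φ (P (suc m)))  ∎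
          where
          Qₛ-tail : Poly F d n
          Qₛ-tail = Σₚ-go d n (λ _ → 0ₚ F d) d (Q-summandₛ k)
          tail-linear : φ Qₛ-tail ≈ ∑[ m < d ] (U (suc k) (suc m) * φ (P (suc m)))
          tail-linear = trans (Σₚ-go-homo lin (λ _ → 0ₚ F d) d (Q-summandₛ k))
                              (sum-cong-≋ {d} (Q-summandₛ-linear k))
          U₀φ≈0 : U (suc k) zero * φ (P zero) ≈ 0#
          U₀φ≈0 = trans (*-congʳ (U-upper (suc k) zero z<s)) (zeroˡ _)

      Q-degree : TotDeg≤ F d (split P) D → ∀ i → TotDeg≤ F d (Q i) (D ∸ toℕ i)
      Q-degree deg i e″ D∸i<∣e″∣ = trans (Q-linear (coeff-linear e″) i) (sum-zero {suc d} vanish)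
        where
        vanish : ∀ m → U i m * coeff F d (P m) e″ ≈ 0#
        vanish m with toℕ m <? toℕ i
        ... | yes m<i = trans (*-congʳ (U-upper i m m<i)) (zeroˡ _)
        ... | no  m≮i = trans (*-congˡ (TotDeg≤-split {P = P} deg m e″ D∸m<∣e″∣)) (zeroʳ _)
          where
          D∸m<∣e″∣ : D ∸ toℕ m < ∣_∣ₑ F d e″
          D∸m<∣e″∣ = ≤-<-trans (∸-monoʳ-≤ D (≮⇒≥ m≮i)) D∸i<∣e″∣

      TrimmedEval-split : (r : Fin (suc d) → Carrier) →
                          (∀ i q → TrimmedEval F d z lu n (D ∸ toℕ i) (Q i) e′ q ≈ r i) →
                          TrimmedEval F d z lu (suc n) D (split P) e h ≈ ∑[ i < suc d ] (L j i * r i)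
      TrimmedEval-split r ih = begin
        TrimmedEval F d z lu (suc n) D (split P) e h  ≡⟨ TrimmedEval-unfold ⟩
        first + Σᵈ-go d (λ _ → 0#) d summandₛ        ≡⟨ ≡.cong (first +_) (Σᵈ-go≡sum d (λ _ → 0#) d summandₛ) ⟩
        first + sum summandₛ                         ≈⟨ +-cong (*-congˡ (ih zero ∣e′∣≤D))
                                                               (sum-cong-≋ {d} (summandₛ-correct r ih)) ⟩
        ∑[ i < suc d ] (L j i * r i)                 ∎
        where
        first : Carrier
        first = L j zero * TrimmedEval F d z lu n D Q₀ e′ ∣e′∣≤D

    TrimmedEval-correct : (z : Nodes F d) (lu : ∀ m → LUDecomposition F d (Vandermonde F d (z m))) →
                          ∀ n D (P : Poly F d n) → TotDeg≤ F d P D → ∀ e h →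
                          TrimmedEval F d z lu n D P e h ≈ eval F d P (Z F d z e)
    TrimmedEval-correct z lu zero    D (const a) deg e h = refl
    TrimmedEval-correct z lu (suc n) D (split P) deg e h = begin
      TrimmedEval F d z lu (suc n) D (split P) e h
        ≈⟨ TrimmedEval-split (λ i → eval F d (Q i) x′) recursion ⟩
      ∑[ i < suc d ] (L j i * eval F d (Q i) x′)
        ≈⟨ sum-cong-≋ {suc d} (λ i → *-congˡ {L j i} (Q-linear (eval-linear x′) i)) ⟩
      ∑[ i < suc d ] (L j i * ∑[ m < suc d ] (U i m * p m))
        ≈⟨ ∑-∑-assoc (L j) U p ⟩
      ∑[ m < suc d ] (∑[ i < suc d ] (L j i * U i m) * p m)
        ≈⟨ sum-cong-≋ {suc d} (λ m → *-congʳ {p m} (V≈∑LU m)) ⟨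
      ∑[ m < suc d ] (pow F d (z n j) (toℕ m) * p m)
        ≈⟨ sum-cong-≋ {suc d} (λ m → *-comm (pow F d (z n j) (toℕ m)) (p m)) ⟩
      ∑[ m < suc d ] (p m * pow F d (z n j) (toℕ m))
        ≡⟨ eval-split-Z z P e ⟨
      eval F d (split P) (Z F d z e)
        ∎
      where
      open TrimmedEvalStep z lu P e h
      open LUDecomposition (lu n)
      j : Fin (suc d)
      j = last F d e
      e′ : Exps F d n
      e′ = init F d e
      x′ : Fin n → Carrier
      x′ = Z F d z e′
      p : Fin (suc d) → Carrier
      p m = eval F d (P m) x′
      recursion : ∀ i q → TrimmedEval F d z lu n (D ∸ toℕ i) (Q i) e′ q ≈ eval F d (Q i) x′
      recursion i = TrimmedEval-correct z lu n (D ∸ toℕ i) (Q i) (Q-degree deg i) e′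
      V≈∑LU : ∀ m → pow F d (z n j) (toℕ m) ≈ ∑[ i < suc d ] (L j i * U i m)
      V≈∑LU m = trans (V≈LU j m) (reflexive (Σᵈ≡sum d (λ i → L j i * U i m)))

mainTheorem3 : ∀ {c ℓ : Level} (F : Field c ℓ) (d : ℕ) → 1 ≤ d →
    (z : Nodes F d) →
    (∀ (i : ℕ) (j j′ : Fin (suc d)) → j ≢ j′ → ¬ Field._≈_ F (z i j) (z i j′)) →
    -- step (3) can be carried out: the Vandermonde matrices have LU decompositions
    ((m : ℕ) → LUDecomposition F d (Vandermonde F d (z m)))
    ×
    -- for every choice of LU decompositions, TrimmedEval outputs P(Z_ℓ) for all ℓ ∈ binom([n], ≤ D)_d
    ((lu : (m : ℕ) → LUDecomposition F d (Vandermonde F d (z m))) →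
     (n D : ℕ) (P : Poly F d n) → TotDeg≤ F d P D →
     (e : Exps F d n) (h : ∣_∣ₑ F d e ≤ D) →
     Field._≈_ F (TrimmedEval F d z lu n D P e h) (eval F d P (Z F d z e)))
mainTheorem3 F d _ z _ = (λ m → Vandermonde-LU F d (z m)) , TrimmedEval-correct F d z
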